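{- For the 2-server problem on the metric consisting of three equidistant collinear points, for a suitable initial configuration of the servers, every deterministic online algorithm has strict bijective ratio at least $2$ against the optimal offline algorithm.
   Context: Metric: three points $1,2,3$ on a line with distance $d>0$ between consecutive points. Two servers occupy points; each request is a point, to which an algorithm must move a server; cost is the total distance moved. The online algorithm and the optimal offline algorithm $\textsc{opt}$ start from the same initial configuration. $\mathcal{I}_n$ is the set of all request sequences of length $n$. The strict bijective ratio of an online algorithm $A$ against $B$ is at most $\rho$ if there is $n_0$ such that for all $n\ge n_0$ there exists a bijection $\pi:\mathcal{I}_n\to\mathcal{I}_n$ with $A(\sigma)\le\rho\cdot B(\pi(\sigma))$ for all $\sigma\in\mathcal{I}_n$; the ratio is the infimum of such $\rho$.
   Formalization: The distance d between consecutive points ranges over the positive rationals, and the bounds ρ for the strict bijective ratio range over the rationals. -}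

module Defs where

open import Data.Nat as ℕ using (ℕ; zero; suc; _+_; _⊓_; ∣_-_∣)
open import Data.Fin using (Fin; toℕ)
open import Data.Fin.Base using () renaming (zero to f0; suc to fs)
open import Data.Product using (Σ; _×_; _,_; proj₁; proj₂; ∃-syntax)
open import Data.Sum using (_⊎_)
open import Data.List using (List; []; _∷_; _∷ʳ_; map; _++_; foldr)
open import Data.Vec using (Vec; []; _∷_)
open import Data.Integer using (+_)
open import Data.Rational using (ℚ; _/_; _*_; _≤_)
open import Function.Bundles using (_⤖_; Bijection)
open import Relation.Binary.PropositionalEquality using (_≡_)

-- The three collinear points 1,2,3 (encoded as 0,1,2).
Point : Set
Point = Fin 3

allPoints : List Point
allPoints = f0 ∷ fs f0 ∷ fs (fs f0) ∷ []

-- Distance in units of d: |i - j|.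
pdist : Point → Point → ℕ
pdist i j = ∣ toℕ i - toℕ j ∣

Config : Set
Config = Point × Point

cdist : Config → Config → ℕ
cdist (a , b) (a' , b') = pdist a a' + pdist b b'

Covers : Point → Config → Set
Covers r c = r ≡ proj₁ c ⊎ r ≡ proj₂ c

-- Deterministic online algorithm (initial configuration fixed externally):
-- given the past requests (in order) and the current request, it chooses
-- the next configuration, which must serve the current request.
OnlineAlg : Set
OnlineAlg = List Point → (r : Point) → Σ Config (Covers r)

algCostFrom : OnlineAlg → Config → List Point → {n : ℕ} → Vec Point n → ℕ
algCostFrom A c h [] = 0
algCostFrom A c h (r ∷ σ) =
  let c' = proj₁ (A h r) in cdist c c' + algCostFrom A c' (h ∷ʳ r) σ

algCost : OnlineAlg → Config → {n : ℕ} → Vec Point n → ℕ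
algCost A c₀ σ = algCostFrom A c₀ [] σ

serving : Point → List Config
serving r = map (λ y → (r , y)) allPoints ++ map (λ x → (x , r)) allPoints

minList : ℕ → List ℕ → ℕ
minList m xs = foldr _⊓_ m xs

-- Optimal offline cost (in units of d): minimum over all feasible
-- configuration schedules, computed by recursion over the first move.
optCost : Config → {n : ℕ} → Vec Point n → ℕ
optCost c [] = 0
optCost c (r ∷ σ) =
  minList (cdist c (r , r) + optCost (r , r) σ)
          (map (λ c' → cdist c c' + optCost c' σ) (serving r))

-- Actual costs with distance d between consecutive points.
scale : ℚ → ℕ → ℚ
scale d k = d * (+ k / 1)

StrictBijRatioAtMost : ℚ → Config → OnlineAlg → ℚ → Set
StrictBijRatioAtMost d c₀ A ρ =
  ∃[ n₀ ] ((n : ℕ) → n₀ ℕ.≤ n →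
    Σ (Vec Point n ⤖ Vec Point n) λ π → ((σ : Vec Point n) →
      scale d (algCost A c₀ σ) ≤ ρ * scale d (optCost c₀ (Bijection.to π σ))))

-- Start with the servers on the outer points 1 and 3. Since a configuration
-- covers at most two points, some request forces the online algorithm to
-- move; hence the request sequences of length n on which it moves at most
-- once number at most w(n), where w(n+1) = 2^n + 2 w(n): after a request to
-- an uncovered point it may never move again. OPT pays at most one move on
-- every sequence that avoids 2, or whose first 2 is followed only by
-- requests served by (1,2) or only by requests served by (2,3); these are
-- strictly more than w(n) once n ≥ 2. A bijection witnessing a ratio below 2
-- must send each sequence on which the algorithm pays at least 2 to one on
-- which OPT pays at least 2, so its inverse injects the sequences that are
-- cheap for OPT into those that are cheap for the algorithm: impossible.
module Submission where

open import Defs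
open import Data.Empty using (⊥-elim)
open import Data.Fin using (Fin; toℕ) renaming (zero to f0; suc to fs)
open import Data.Integer as ℤ using (+_)
import Data.Integer.Properties as ℤP
open import Data.List using (List; []; _∷_; [_]; _++_; _∷ʳ_; map; length; lookup)
open import Data.List.Properties using (length-++; length-map)
open import Data.List.Membership.Propositional using (_∈_)
open import Data.List.Membership.Propositional.Properties
  using (∈-lookup; ∈-map⁺; ∈-map⁻; ∈-++⁺ˡ; ∈-++⁺ʳ; ∈-++⁻)
open import Data.List.Relation.Unary.All as All using (All; []; _∷_)
import Data.List.Relation.Unary.All.Properties as Allₚ
open import Data.List.Relation.Unary.Any using (here; there; index)
open import Data.List.Relation.Unary.Any.Properties using (lookup-index)
open import Data.List.Relation.Unary.AllPairs using ([]; _∷_)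
open import Data.List.Relation.Unary.Unique.Propositional using (Unique)
import Data.List.Relation.Unary.Unique.Propositional.Properties as Uniqueₚ
open import Data.List.Relation.Binary.Disjoint.Propositional using (Disjoint)
open import Data.Nat as ℕ using (ℕ; zero; suc; _+_; _^_; z≤n; s≤s)
import Data.Nat.Properties as ℕP
open import Data.Nat.Coprimality as Coprime using (1-coprimeTo)
open import Data.Fin.Properties using (injective⇒≤; toℕ-injective)
open import Data.Product using (∃-syntax; _×_; _,_; proj₁; proj₂)
open import Data.Rational as ℚ using (ℚ; 0ℚ; _<_; _/_; mkℚ; *≤*)
import Data.Rational.Properties as ℚP
open import Data.Sum as Sum using (_⊎_; inj₁; inj₂)
open import Data.Vec using (Vec; []; _∷_; head)
open import Data.Vec.Properties using (∷-injectiveʳ)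
open import Function using (_∘_)
open import Function.Bundles using (_⤖_; Bijection; Surjection)
open import Function.Definitions using (Injective)
open import Relation.Binary.PropositionalEquality hiding ([_])
open import Relation.Nullary using (¬_)

module _ {X Y : Set} where

  Unique⇒lookup-injective : {xs : List X} → Unique xs → Injective _≡_ _≡_ (lookup xs)
  Unique⇒lookup-injective (_ ∷ _) {f0} {f0} _ = refl
  Unique⇒lookup-injective (x∉ ∷ _) {f0} {fs j} eq = ⊥-elim (All.lookup x∉ (∈-lookup j) eq)
  Unique⇒lookup-injective (x∉ ∷ _) {fs i} {f0} eq = ⊥-elim (All.lookup x∉ (∈-lookup i) (sym eq))
  Unique⇒lookup-injective (_ ∷ u) {fs i} {fs j} eq = cong fs (Unique⇒lookup-injective u eq)

  injection⇒length≤ : {xs : List X} {ys : List Y} {f : X → Y} → Unique xs → Injective _≡_ _≡_ f →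
                      (∀ {x} → x ∈ xs → f x ∈ ys) → length xs ℕ.≤ length ys
  injection⇒length≤ {xs} {ys} {f} xs! f-inj f∈ = injective⇒≤ {f = position} position-injective
    where
    position : Fin (length xs) → Fin (length ys)
    position i = index (f∈ (∈-lookup i))

    position-injective : Injective _≡_ _≡_ position
    position-injective {i} {j} eq = Unique⇒lookup-injective xs! (f-inj (begin
      f (lookup xs i)          ≡⟨ lookup-index (f∈ (∈-lookup i)) ⟩
      lookup ys (position i)   ≡⟨ cong (lookup ys) eq ⟩
      lookup ys (position j)   ≡⟨ lookup-index (f∈ (∈-lookup j)) ⟨
      f (lookup xs j)          ∎))
      where open ≡-Reasoning

pattern p₁ = f0
pattern p₂ = fs f0
pattern p₃ = fs (fs f0)

pdist≡0⇒≡ : ∀ i j → pdist i j ≡ 0 → i ≡ j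
pdist≡0⇒≡ i j eq = toℕ-injective (ℕP.∣m-n∣≡0⇒m≡n eq)

cdist≡0⇒≡ : ∀ c c' → cdist c c' ≡ 0 → c ≡ c'
cdist≡0⇒≡ (a , b) (a' , b') eq = cong₂ _,_
  (pdist≡0⇒≡ a a' (ℕP.m+n≡0⇒m≡0 (pdist a a') eq))
  (pdist≡0⇒≡ b b' (ℕP.m+n≡0⇒n≡0 (pdist a a') eq))

cdist-refl : ∀ c → cdist c c ≡ 0
cdist-refl (a , b) = cong₂ _+_ (ℕP.∣n-n∣≡0 (toℕ a)) (ℕP.∣n-n∣≡0 (toℕ b))

cdist-pos : ∀ {r c c'} → ¬ Covers r c → Covers r c' → 1 ℕ.≤ cdist c c'
cdist-pos {r} {c} {c'} ¬cov cov = ℕP.n≢0⇒n>0 λ eq →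
  ¬cov (subst (Covers r) (sym (cdist≡0⇒≡ c c' eq)) cov)

missing : Point → Point → Point
missing p₁ p₁ = p₂
missing p₁ p₂ = p₃
missing p₁ p₃ = p₂
missing p₂ p₁ = p₃
missing p₂ p₂ = p₁
missing p₂ p₃ = p₁
missing p₃ p₁ = p₂
missing p₃ p₂ = p₁
missing p₃ p₃ = p₁

missing-uncovered : ∀ x y → ¬ Covers (missing x y) (x , y)
missing-uncovered p₁ p₁ = λ { (inj₁ ()) ; (inj₂ ()) }
missing-uncovered p₁ p₂ = λ { (inj₁ ()) ; (inj₂ ()) }
missing-uncovered p₁ p₃ = λ { (inj₁ ()) ; (inj₂ ()) }
missing-uncovered p₂ p₁ = λ { (inj₁ ()) ; (inj₂ ()) }
missing-uncovered p₂ p₂ = λ { (inj₁ ()) ; (inj₂ ()) }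
missing-uncovered p₂ p₃ = λ { (inj₁ ()) ; (inj₂ ()) }
missing-uncovered p₃ p₁ = λ { (inj₁ ()) ; (inj₂ ()) }
missing-uncovered p₃ p₂ = λ { (inj₁ ()) ; (inj₂ ()) }
missing-uncovered p₃ p₃ = λ { (inj₁ ()) ; (inj₂ ()) }

others : Point → Point × Point
others p₁ = p₂ , p₃
others p₂ = p₁ , p₃
others p₃ = p₁ , p₂

point-cases : ∀ u r → r ≡ u ⊎ r ≡ proj₁ (others u) ⊎ r ≡ proj₂ (others u)
point-cases p₁ p₁ = inj₁ refl
point-cases p₁ p₂ = inj₂ (inj₁ refl)
point-cases p₁ p₃ = inj₂ (inj₂ refl)
point-cases p₂ p₁ = inj₂ (inj₁ refl)
point-cases p₂ p₂ = inj₁ refl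
point-cases p₂ p₃ = inj₂ (inj₂ refl)
point-cases p₃ p₁ = inj₂ (inj₁ refl)
point-cases p₃ p₂ = inj₂ (inj₂ refl)
point-cases p₃ p₃ = inj₁ refl

infixr 6 _◃_

_◃_ : ∀ {n} → Point → List (Vec Point n) → List (Vec Point (suc n))
a ◃ xs = map (a ∷_) xs

private variable
  n : ℕ
  a b c : Point
  xs ys zs : List (Vec Point n)

length-◃-++ : {ys : List (Vec Point (suc n))} → length (a ◃ xs ++ ys) ≡ length xs + length ys
length-◃-++ {a = a} {xs = xs} {ys} = trans (length-++ (a ◃ xs)) (cong (_+ length ys) (length-map (a ∷_) xs))

length-◃³ : length (a ◃ xs ++ b ◃ ys ++ c ◃ zs) ≡ length xs + (length ys + length zs)
length-◃³ {a = a} {xs = xs} {b = b} {ys = ys} {c = c} {zs = zs} = begin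
  length (a ◃ xs ++ b ◃ ys ++ c ◃ zs)      ≡⟨ length-◃-++ {xs = xs} ⟩
  length xs + length (b ◃ ys ++ c ◃ zs)    ≡⟨ cong (λ t → length xs + t) (length-◃-++ {xs = ys}) ⟩
  length xs + (length ys + length (c ◃ zs)) ≡⟨ cong (λ t → length xs + (length ys + t)) (length-map (c ∷_) zs) ⟩
  length xs + (length ys + length zs)      ∎
  where open ≡-Reasoning

head-◃ : ∀ {v} → v ∈ a ◃ xs → head v ≡ a
head-◃ {a = a} v∈ with ∈-map⁻ (a ∷_) v∈
... | _ , _ , refl = refl

◃-disjoint : a ≢ b → Disjoint (a ◃ xs) (b ◃ ys)
◃-disjoint a≢b (v∈a◃ , v∈b◃) = a≢b (trans (sym (head-◃ v∈a◃)) (head-◃ v∈b◃))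

++-disjoint : Disjoint xs ys → Disjoint xs zs → Disjoint xs (ys ++ zs)
++-disjoint {ys = ys} xs#ys xs#zs (v∈xs , v∈ys++zs) with ∈-++⁻ ys v∈ys++zs
... | inj₁ v∈ys = xs#ys (v∈xs , v∈ys)
... | inj₂ v∈zs = xs#zs (v∈xs , v∈zs)

module _ {P : Vec Point (suc n) → Set} where

  All-◃² : All (P ∘ (a ∷_)) xs → All (P ∘ (b ∷_)) ys → All P (a ◃ xs ++ b ◃ ys)
  All-◃² pxs pys = Allₚ.++⁺ (Allₚ.map⁺ pxs) (Allₚ.map⁺ pys)

  All-◃³ : All (P ∘ (a ∷_)) xs → All (P ∘ (b ∷_)) ys → All (P ∘ (c ∷_)) zs →
           All P (a ◃ xs ++ b ◃ ys ++ c ◃ zs)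
  All-◃³ pxs pys pzs = Allₚ.++⁺ (Allₚ.map⁺ pxs) (All-◃² pys pzs)

∈-◃-++⁺ˡ : ∀ {σ} → σ ∈ xs → a ∷ σ ∈ a ◃ xs ++ ys
∈-◃-++⁺ˡ {a = a} σ∈ = ∈-++⁺ˡ (∈-map⁺ (a ∷_) σ∈)

∈-◃³⁺ᵐ : ∀ {σ} xs → σ ∈ ys → b ∷ σ ∈ a ◃ xs ++ b ◃ ys ++ zs
∈-◃³⁺ᵐ {a = a} xs σ∈ = ∈-++⁺ʳ (a ◃ xs) (∈-◃-++⁺ˡ σ∈)

∈-◃³⁺ʳ : ∀ {σ} xs ys → σ ∈ zs → c ∷ σ ∈ a ◃ xs ++ b ◃ ys ++ c ◃ zs
∈-◃³⁺ʳ {c = c} {a = a} {b = b} xs ys σ∈ = ∈-++⁺ʳ (a ◃ xs) (∈-++⁺ʳ (b ◃ ys) (∈-map⁺ (c ∷_) σ∈))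

◃-unique : Unique xs → Unique (a ◃ xs)
◃-unique = Uniqueₚ.map⁺ ∷-injectiveʳ

◃²-unique : a ≢ b → Unique xs → Unique ys → Unique (a ◃ xs ++ b ◃ ys)
◃²-unique a≢b xs! ys! = Uniqueₚ.++⁺ (◃-unique xs!) (◃-unique ys!) (◃-disjoint a≢b)

◃³-unique : a ≢ b → a ≢ c → b ≢ c → Unique xs → Unique ys → Unique zs →
            Unique (a ◃ xs ++ b ◃ ys ++ c ◃ zs)
◃³-unique {b = b} {ys = ys} a≢b a≢c b≢c xs! ys! zs! =
  Uniqueₚ.++⁺ (◃-unique xs!) (◃²-unique b≢c ys! zs!)
    (++-disjoint {ys = b ◃ ys} (◃-disjoint a≢b) (◃-disjoint a≢c))

staticWords : Config → (n : ℕ) → List (Vec Point n)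
staticWords c zero    = [ [] ]
staticWords c (suc n) = proj₁ c ◃ staticWords c n ++ proj₂ c ◃ staticWords c n

length-staticWords : ∀ c n → length (staticWords c n) ≡ 2 ^ n
length-staticWords c zero    = refl
length-staticWords c (suc n) = begin
  length (staticWords c (suc n))                                 ≡⟨ length-◃-++ {xs = staticWords c n} ⟩
  length (staticWords c n) + length (proj₂ c ◃ staticWords c n)  ≡⟨ cong₂ _+_ ih (trans (length-map _ (staticWords c n)) ih) ⟩
  2 ^ n + 2 ^ n                                                  ≡⟨ cong (λ t → 2 ^ n + t) (ℕP.+-identityʳ (2 ^ n)) ⟨
  2 ^ suc n                                                      ∎
  where
  open ≡-Reasoning
  ih : length (staticWords c n) ≡ 2 ^ n
  ih = length-staticWords c n

staticWords-unique : ∀ {c} n → proj₁ c ≢ proj₂ c → Unique (staticWords c n)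
staticWords-unique zero    _  = [] ∷ []
staticWords-unique (suc n) x≢y = ◃²-unique x≢y (staticWords-unique n x≢y) (staticWords-unique n x≢y)

minList-≤ : ∀ m xs {x} → x ∈ xs → minList m xs ℕ.≤ x
minList-≤ m (y ∷ xs) (here refl) = ℕP.m⊓n≤m y _
minList-≤ m (y ∷ xs) (there x∈) = ℕP.≤-trans (ℕP.m⊓n≤n y _) (minList-≤ m xs x∈)

∈-allPoints : ∀ p → p ∈ allPoints
∈-allPoints p₁ = here refl
∈-allPoints p₂ = there (here refl)
∈-allPoints p₃ = there (there (here refl))

∈-serving : ∀ {r} c → Covers r c → c ∈ serving r
∈-serving {r} (x , y) (inj₁ refl) = ∈-++⁺ˡ (∈-map⁺ (r ,_) (∈-allPoints y))
∈-serving {r} (x , y) (inj₂ refl) = ∈-++⁺ʳ (map (r ,_) allPoints) (∈-map⁺ (_, r) (∈-allPoints x))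

optCost-move : ∀ {r} c c' {n} (σ : Vec Point n) → Covers r c' → optCost c (r ∷ σ) ℕ.≤ cdist c c' + optCost c' σ
optCost-move c c' σ cov = minList-≤ _ _ (∈-map⁺ (λ c' → cdist c c' + optCost c' σ) (∈-serving c' cov))

optCost-stay : ∀ {r} c {n} (σ : Vec Point n) → Covers r c → optCost c (r ∷ σ) ℕ.≤ optCost c σ
optCost-stay c σ cov = ℕP.≤-trans (optCost-move c c σ cov) (ℕP.≤-reflexive (cong (_+ optCost c σ) (cdist-refl c)))

optCost-stay-free : ∀ {r} c {n} (σ : Vec Point n) → Covers r c → optCost c σ ≡ 0 → optCost c (r ∷ σ) ≡ 0
optCost-stay-free c σ cov free = ℕP.n≤0⇒n≡0 (ℕP.≤-trans (optCost-stay c σ cov) (ℕP.≤-reflexive free))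

optCost-staticWords : ∀ c n → All (λ σ → optCost c σ ≡ 0) (staticWords c n)
optCost-staticWords c zero    = refl ∷ []
optCost-staticWords c (suc n) = All-◃²
  (All.map (λ {σ} → optCost-stay-free c σ (inj₁ refl)) (optCost-staticWords c n))
  (All.map (λ {σ} → optCost-stay-free c σ (inj₂ refl)) (optCost-staticWords c n))

ServedAdjacently : Vec Point n → Set
ServedAdjacently σ = optCost (p₁ , p₂) σ ≡ 0 ⊎ optCost (p₂ , p₃) σ ≡ 0

adjacentWords : (n : ℕ) → List (Vec Point n)
adjacentWords zero    = [ [] ]
adjacentWords (suc n) = p₂ ◃ adjacentWords n ++ p₁ ◃ staticWords (p₁ , p₂) n ++ p₃ ◃ staticWords (p₂ , p₃) n

optCheapWords : (n : ℕ) → List (Vec Point n)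
optCheapWords zero    = [ [] ]
optCheapWords (suc n) = p₂ ◃ adjacentWords n ++ p₁ ◃ optCheapWords n ++ p₃ ◃ optCheapWords n

optCost-adjacentWords : ∀ n → All ServedAdjacently (adjacentWords n)
optCost-adjacentWords zero    = inj₁ refl ∷ []
optCost-adjacentWords (suc n) = All-◃³
  (All.map (λ {σ} → Sum.map (optCost-stay-free (p₁ , p₂) σ (inj₂ refl))
                            (optCost-stay-free (p₂ , p₃) σ (inj₁ refl)))
    (optCost-adjacentWords n))
  (All.map (λ {σ} → inj₁ ∘ optCost-stay-free (p₁ , p₂) σ (inj₁ refl)) (optCost-staticWords (p₁ , p₂) n))
  (All.map (λ {σ} → inj₂ ∘ optCost-stay-free (p₂ , p₃) σ (inj₂ refl)) (optCost-staticWords (p₂ , p₃) n))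

optCost-optCheapWords : ∀ n → All (λ σ → optCost (p₁ , p₃) σ ℕ.≤ 1) (optCheapWords n)
optCost-optCheapWords zero    = z≤n ∷ []
optCost-optCheapWords (suc n) = All-◃³
  (All.map (λ {σ} → moveToAdjacent σ) (optCost-adjacentWords n))
  (All.map (λ {σ} → ℕP.≤-trans (optCost-stay (p₁ , p₃) σ (inj₁ refl))) (optCost-optCheapWords n))
  (All.map (λ {σ} → ℕP.≤-trans (optCost-stay (p₁ , p₃) σ (inj₂ refl))) (optCost-optCheapWords n))
  where
  moveToAdjacent : ∀ σ → ServedAdjacently σ → optCost (p₁ , p₃) (p₂ ∷ σ) ℕ.≤ 1
  moveToAdjacent σ (inj₁ free) =
    ℕP.≤-trans (optCost-move (p₁ , p₃) (p₁ , p₂) σ (inj₂ refl)) (ℕP.≤-reflexive (cong suc free))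
  moveToAdjacent σ (inj₂ free) =
    ℕP.≤-trans (optCost-move (p₁ , p₃) (p₂ , p₃) σ (inj₁ refl)) (ℕP.≤-reflexive (cong suc free))

adjacentWords-unique : ∀ n → Unique (adjacentWords n)
adjacentWords-unique zero    = [] ∷ []
adjacentWords-unique (suc n) = ◃³-unique (λ ()) (λ ()) (λ ())
  (adjacentWords-unique n) (staticWords-unique n (λ ())) (staticWords-unique n (λ ()))

optCheapWords-unique : ∀ n → Unique (optCheapWords n)
optCheapWords-unique zero    = [] ∷ []
optCheapWords-unique (suc n) = ◃³-unique (λ ()) (λ ()) (λ ())
  (adjacentWords-unique n) (optCheapWords-unique n) (optCheapWords-unique n)

adjacentCount : ℕ → ℕ
adjacentCount zero    = 1
adjacentCount (suc n) = adjacentCount n + (2 ^ n + 2 ^ n)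

optCount : ℕ → ℕ
optCount zero    = 1
optCount (suc n) = adjacentCount n + (optCount n + optCount n)

length-adjacentWords : ∀ n → length (adjacentWords n) ≡ adjacentCount n
length-adjacentWords zero    = refl
length-adjacentWords (suc n) = trans (length-◃³ {xs = adjacentWords n} {ys = staticWords (p₁ , p₂) n})
  (cong₂ _+_ (length-adjacentWords n) (cong₂ _+_ (length-staticWords _ n) (length-staticWords _ n)))

length-optCheapWords : ∀ n → length (optCheapWords n) ≡ optCount n
length-optCheapWords zero    = refl
length-optCheapWords (suc n) = trans (length-◃³ {xs = adjacentWords n} {ys = optCheapWords n})
  (cong₂ _+_ (length-adjacentWords n) (cong₂ _+_ (length-optCheapWords n) (length-optCheapWords n)))

onlineCount : ℕ → ℕ
onlineCount zero    = 1
onlineCount (suc n) = 2 ^ n + (onlineCount n + onlineCount n)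

m+n≤1⇒n≡0 : ∀ {m n} → 1 ℕ.≤ m → m + n ℕ.≤ 1 → n ≡ 0
m+n≤1⇒n≡0 {m} {n} 1≤m m+n≤1 =
  ℕP.n≤0⇒n≡0 (ℕP.+-cancelˡ-≤ 1 n 0 (ℕP.≤-trans (ℕP.+-monoˡ-≤ n 1≤m) m+n≤1))

module _ (A : OnlineAlg) where

  move : List Point → Point → Config
  move h r = proj₁ (A h r)

  -- A request to the point missing from the configuration makes A move, so it must stay put afterwards.
  onlineCheapWords : Config → List Point → (n : ℕ) → List (Vec Point n)
  onlineCheapWords c       h zero    = [ [] ]
  onlineCheapWords (x , y) h (suc n) =
    u ◃ staticWords (move h u) n ++
    v ◃ onlineCheapWords (move h v) (h ∷ʳ v) n ++
    w ◃ onlineCheapWords (move h w) (h ∷ʳ w) n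
    where
    u v w : Point
    u = missing x y
    v = proj₁ (others u)
    w = proj₂ (others u)

  length-onlineCheapWords : ∀ c h n → length (onlineCheapWords c h n) ≡ onlineCount n
  length-onlineCheapWords c       h zero    = refl
  length-onlineCheapWords (x , y) h (suc n) =
    trans (length-◃³ {xs = staticWords (move h u) n} {ys = onlineCheapWords (move h v) (h ∷ʳ v) n})
      (cong₂ _+_ (length-staticWords _ n) (cong₂ _+_ (length-onlineCheapWords _ _ n) (length-onlineCheapWords _ _ n)))
    where
    u v : Point
    u = missing x y
    v = proj₁ (others u)

  staticWords-complete : ∀ c h {n} (σ : Vec Point n) → algCostFrom A c h σ ≡ 0 → σ ∈ staticWords c n
  staticWords-complete c h []      _ = here refl
  staticWords-complete c h (r ∷ σ) cost≡0 with A h r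
  ... | c' , cov with cdist≡0⇒≡ c c' (ℕP.m+n≡0⇒m≡0 (cdist c c') cost≡0)
  ... | refl with cov
  ... | inj₁ refl = ∈-◃-++⁺ˡ (staticWords-complete c (h ∷ʳ r) σ (ℕP.m+n≡0⇒n≡0 (cdist c c) cost≡0))
  ... | inj₂ refl = ∈-++⁺ʳ (proj₁ c ◃ staticWords c _)
                      (∈-map⁺ (r ∷_) (staticWords-complete c (h ∷ʳ r) σ (ℕP.m+n≡0⇒n≡0 (cdist c c) cost≡0)))

  onlineCheapWords-complete : ∀ c h {n} (σ : Vec Point n) → algCostFrom A c h σ ℕ.≤ 1 → σ ∈ onlineCheapWords c h n
  onlineCheapWords-complete c       h []      _ = here refl
  onlineCheapWords-complete (x , y) h (r ∷ σ) cost≤1 with point-cases (missing x y) r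
  ... | inj₁ refl = ∈-◃-++⁺ˡ (staticWords-complete (move h r) (h ∷ʳ r) σ
          (m+n≤1⇒n≡0 (cdist-pos (missing-uncovered x y) (proj₂ (A h r))) cost≤1))
  ... | inj₂ (inj₁ refl) = ∈-◃³⁺ᵐ (staticWords (move h u) _)
          (onlineCheapWords-complete (move h r) (h ∷ʳ r) σ (ℕP.≤-trans (ℕP.m≤n+m _ _) cost≤1))
    where u : Point
          u = missing x y
  ... | inj₂ (inj₂ refl) = ∈-◃³⁺ʳ (staticWords (move h u) _) (onlineCheapWords (move h v) (h ∷ʳ v) _)
          (onlineCheapWords-complete (move h r) (h ∷ʳ r) σ (ℕP.≤-trans (ℕP.m≤n+m _ _) cost≤1))
    where u v : Point
          u = missing x y
          v = proj₁ (others u)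

1≤adjacentCount : ∀ n → 1 ℕ.≤ adjacentCount n
1≤adjacentCount zero    = ℕP.≤-refl
1≤adjacentCount (suc n) = ℕP.≤-trans (1≤adjacentCount n) (ℕP.m≤m+n _ _)

2^<adjacentCount : ∀ n → 2 ^ suc n ℕ.< adjacentCount (suc n)
2^<adjacentCount n = begin-strict
  2 ^ suc n                     ≡⟨ cong (λ t → 2 ^ n + t) (ℕP.+-identityʳ (2 ^ n)) ⟩
  2 ^ n + 2 ^ n                 <⟨ ℕP.+-monoˡ-≤ (2 ^ n + 2 ^ n) (1≤adjacentCount n) ⟩
  adjacentCount (suc n)         ∎
  where open ℕP.≤-Reasoning

2^≤adjacentCount : ∀ n → 2 ^ n ℕ.≤ adjacentCount n
2^≤adjacentCount zero    = ℕP.≤-refl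
2^≤adjacentCount (suc n) = ℕP.<⇒≤ (2^<adjacentCount n)

onlineCount≤optCount : ∀ n → onlineCount n ℕ.≤ optCount n
onlineCount≤optCount zero    = ℕP.≤-refl
onlineCount≤optCount (suc n) = ℕP.+-mono-≤ (2^≤adjacentCount n) (ℕP.+-mono-≤ ih ih)
  where
  ih : onlineCount n ℕ.≤ optCount n
  ih = onlineCount≤optCount n

onlineCount<optCount : ∀ n → onlineCount (2 + n) ℕ.< optCount (2 + n)
onlineCount<optCount n = ℕP.+-mono-<-≤ (2^<adjacentCount n) (ℕP.+-mono-≤ ih ih)
  where
  ih : onlineCount (suc n) ℕ.≤ optCount (suc n)
  ih = onlineCount≤optCount (suc n)

ℕ/1≡mkℚ : ∀ m → + m / 1 ≡ mkℚ (+ m) 0 (Coprime.sym (1-coprimeTo m))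
ℕ/1≡mkℚ m = ℚP.normalize-coprime (Coprime.sym (1-coprimeTo m))

ℕ/1-mono-≤ : ∀ {a b} → a ℕ.≤ b → + a / 1 ℚ.≤ + b / 1
ℕ/1-mono-≤ {a} {b} a≤b rewrite ℕ/1≡mkℚ a | ℕ/1≡mkℚ b =
  *≤* (subst₂ ℤ._≤_ (sym (ℤP.*-identityʳ (+ a))) (sym (ℤP.*-identityʳ (+ b))) (ℤ.+≤+ a≤b))

module _ {d ρ : ℚ} (0<d : 0ℚ < d) (ρ<2 : ρ < + 2 / 1) where

  private instance
    d-positive : ℚ.Positive d
    d-positive = ℚ.positive 0<d

    d-nonNegative : ℚ.NonNegative d
    d-nonNegative = ℚP.pos⇒nonNeg d

  ρ*scale<scale2 : ∀ k → k ℕ.≤ 1 → ρ ℚ.* scale d k < scale d 2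
  ρ*scale<scale2 0 _ rewrite ℚP.*-zeroʳ d | ℚP.*-zeroʳ ρ =
    subst (_< d ℚ.* (+ 2 / 1)) (ℚP.*-zeroʳ d) (ℚP.*-monoʳ-<-pos d (ℚP.positive⁻¹ (+ 2 / 1)))
  ρ*scale<scale2 1 _ rewrite ℚP.*-identityʳ d | ℚP.*-comm d (+ 2 / 1) = ℚP.*-monoˡ-<-pos d ρ<2
  ρ*scale<scale2 (suc (suc _)) (s≤s ())

  ratio<2⇒cost≤1 : ∀ {a k} → k ℕ.≤ 1 → scale d a ℚ.≤ ρ ℚ.* scale d k → a ℕ.≤ 1
  ratio<2⇒cost≤1 {a} {k} k≤1 a≤ρk = ℕP.≮⇒≥ λ 1<a → ℚP.<-irrefl refl (begin-strict
    scale d 2         ≤⟨ ℚP.*-monoˡ-≤-nonNeg d (ℕ/1-mono-≤ 1<a) ⟩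
    scale d a         ≤⟨ a≤ρk ⟩
    ρ ℚ.* scale d k   <⟨ ρ*scale<scale2 k k≤1 ⟩
    scale d 2         ∎)
    where open ℚP.≤-Reasoning

optCount≤onlineCount : ∀ A {d ρ} → 0ℚ < d → ρ < + 2 / 1 → ∀ {n} (π : Vec Point n ⤖ Vec Point n) →
  (∀ σ → scale d (algCost A (p₁ , p₃) σ) ℚ.≤ ρ ℚ.* scale d (optCost (p₁ , p₃) (Bijection.to π σ))) →
  optCount n ℕ.≤ onlineCount n
optCount≤onlineCount A {d} {ρ} 0<d ρ<2 {n} π ratio = begin
  optCount n                                  ≡⟨ length-optCheapWords n ⟨
  length (optCheapWords n)                    ≤⟨ injection⇒length≤ (optCheapWords-unique n) to⁻-injective to⁻-cheap ⟩
  length (onlineCheapWords A (p₁ , p₃) [] n)  ≡⟨ length-onlineCheapWords A (p₁ , p₃) [] n ⟩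
  onlineCount n                               ∎
  where
  open ℕP.≤-Reasoning
  open Bijection π using (to; to⁻)
  open Surjection (Bijection.surjection π) using (to∘to⁻)

  to⁻-injective : Injective _≡_ _≡_ to⁻
  to⁻-injective {τ} {τ'} eq = trans (sym (to∘to⁻ τ)) (trans (cong to eq) (to∘to⁻ τ'))

  to⁻-cheap : ∀ {τ} → τ ∈ optCheapWords n → to⁻ τ ∈ onlineCheapWords A (p₁ , p₃) [] n
  to⁻-cheap {τ} τ∈ = onlineCheapWords-complete A (p₁ , p₃) [] (to⁻ τ)
    (ratio<2⇒cost≤1 0<d ρ<2 (All.lookup (optCost-optCheapWords n) τ∈)
      (subst (λ τ' → scale d (algCost A (p₁ , p₃) (to⁻ τ)) ℚ.≤ ρ ℚ.* scale d (optCost (p₁ , p₃) τ'))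
        (to∘to⁻ τ) (ratio (to⁻ τ))))

theorem6 : ∃[ c₀ ] ((A : OnlineAlg) (d ρ : ℚ) → 0ℚ < d → ρ < (+ 2 / 1) → ¬ StrictBijRatioAtMost d c₀ A ρ)
theorem6 = (p₁ , p₃) , λ A d ρ 0<d ρ<2 (n₀ , ratio) →
  let (π , bounded) = ratio (2 + n₀) (ℕP.m≤n+m n₀ 2)
  in ℕP.<⇒≱ (onlineCount<optCount n₀) (optCount≤onlineCount A 0<d ρ<2 π bounded)
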